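{- Let $\dot{G}=(G,\sigma)$ be an unbalanced signed graph of order $n$. If $e(\dot{G}) \ge \frac{n(n-1)}{2}-2(n-3)$, then $\dot{G}$ contains a negative cycle of length at most $4$.
   Context: A signed graph $\dot G=(G,\sigma)$ is a simple graph $G$ with a sign function $\sigma:E(G)\to\{+1,-1\}$, and $e(\dot G)=|E(G)|$. The sign of a cycle is the product of the signs of its edges. $\dot G$ is balanced if it is switching equivalent to an all-positive signed graph (equivalently, all its cycles are positive), and unbalanced otherwise; switching at a vertex subset $U$ reverses the signs of all edges between $U$ and its complement. -}

module Defs where

open import Data.Nat using (ℕ; zero; suc; _≤_; _<_; _<ᵇ_)
open import Data.Fin using (Fin; toℕ)
open import Data.Bool using (Bool; true; false; if_then_else_)
open import Data.Maybe using (Maybe; just; nothing; is-just)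
open import Data.Sign using (Sign) renaming (_*_ to _*ₛ_)
open import Data.List using (List; length; filter; allFin; concatMap; map)
open import Data.Vec using (Vec; []; _∷_; _∷ʳ_; lookup; foldr)
open import Data.Product using (Σ; _×_; _,_; ∃-syntax)
open import Relation.Binary.PropositionalEquality using (_≡_)
open import Relation.Nullary using (¬_)
open import Function.Definitions using (Injective)
open import Data.Nat.Properties using (_<?_)

-- A signed graph on vertex set Fin n: adj i j = nothing if ij is not an edge,
-- and just s if ij is an edge with sign s.  Simple: symmetric and loopless.
record SignedGraph (n : ℕ) : Set where
  field
    adj   : Fin n → Fin n → Maybe Sign
    sym   : ∀ i j → adj i j ≡ adj j i
    loop  : ∀ i → adj i i ≡ nothing
open SignedGraph public

edgeCount : ∀ {n} → SignedGraph n → ℕ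
edgeCount {n} G =
  length (filter (λ p → is-just (adj G (Data.Product.proj₁ p) (Data.Product.proj₂ p)) Data.Bool.≟ true)
    (concatMap (λ i → map (λ j → (i , j))
                          (filter (λ j → toℕ i <? toℕ j) (allFin n)))
               (allFin n)))

-- switching function U ⊆ V(G) given by its indicator; sign contribution
switchSign : Bool → Sign
switchSign true  = Sign.-
switchSign false = Sign.+

-- Ġ is balanced: switching equivalent to the all-positive signed graph,
-- i.e. some switching set U makes every edge positive.
Balanced : ∀ {n} → SignedGraph n → Set
Balanced {n} G = Σ (Fin n → Bool) λ U → ∀ i j s → adj G i j ≡ just s →
  (switchSign (U i) *ₛ s) *ₛ switchSign (U j) ≡ Sign.+

Unbalanced : ∀ {n} → SignedGraph n → Set
Unbalanced G = ¬ Balanced G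

rotate : ∀ {A : Set} {k} → Vec A k → Vec A k
rotate []       = []
rotate (x ∷ xs) = xs ∷ʳ x

record Cycle {n} (G : SignedGraph n) (k : ℕ) : Set where
  field
    len≥3    : 3 ≤ k
    verts    : Vec (Fin n) k
    distinct : Injective _≡_ _≡_ (lookup verts)
    signs    : Vec Sign k
    edges    : ∀ i → adj G (lookup verts i) (lookup (rotate verts) i) ≡ just (lookup signs i)
open Cycle public

cycleSign : ∀ {n} {G : SignedGraph n} {k} → Cycle G k → Sign
cycleSign C = foldr _ _*ₛ_ Sign.+ (signs C)

-- Call the non-degree of a vertex the number of other vertices not adjacent to it; the density
-- hypothesis says that the non-degrees sum to at most 4n − 12. Assuming every triangle and every
-- 4-cycle is positive, we switch the graph to an all-positive one. Fix v of minimum non-degree t,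
-- so t ≤ 3. Give v the sign +, a neighbour m of v the sign of vm, and a vertex x at distance two the
-- sign of a path v m x; positive 4-cycles v m x m′ make this independent of m. A far vertex (seen by
-- no neighbour of v) has non-degree at least n − t, and counting shows there is at most one, that
-- then t ≤ 2, and that it has at most one neighbour, so that edge alone fixes its sign. Edges among
-- the neighbours of v are balanced by triangles through v. For an edge xy between vertices at
-- distance two, either a neighbour of v sees both (a triangle), or a neighbour of v seeing x is
-- adjacent to one seeing y (a triangle through v and a 4-cycle); if neither, x, y and two such
-- neighbours have so many non-neighbours that the non-degree sum exceeds 4n − 12.

module Submission where

open import Defs hiding (sym)

open import Level using (Level; 0ℓ)
open import Data.Nat using (ℕ; zero; suc; _+_; _*_; _∸_; _≤_; _<_; z≤n; s≤s)
open import Data.Nat.Properties hiding (_≟_)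
open import Data.Nat.Tactic.RingSolver using (solve-∀)
import Data.Nat.ListAction as List
open import Data.Nat.ListAction.Properties using (sum-++)
open import Data.Fin using (Fin; toℕ; punchIn) renaming (zero to fzero; suc to fsuc)
open import Data.Fin.Properties using (_≟_; any?; punchInᵢ≢i; toℕ-injective)
open import Data.Bool using (Bool; true; false; if_then_else_)
import Data.Bool as Bool
open import Data.Maybe using (Maybe; just; nothing; is-just)
open import Data.Maybe.Properties using (just-injective)
open import Data.Sign using (Sign) renaming (_*_ to _*ₛ_)
import Data.Sign.Properties as Signₚ
open import Data.List using (List; []; _∷_; _++_; length; filter; map; concatMap; allFin; tabulate)
open import Data.List.Properties using (map-++; map-∘; map-tabulate)
open import Data.List.Extrema ≤-totalOrder using (argmin; f[argmin]≤f[xs])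
import Data.List.Relation.Unary.All as All
open import Data.List.Membership.Propositional.Properties using (∈-allFin)
open import Data.Vec using ([]; _∷_)
open import Data.Vec.Relation.Unary.All using ([]; _∷_)
open import Data.Vec.Relation.Unary.Unique.Propositional using (Unique; []; _∷_)
open import Data.Vec.Relation.Unary.Unique.Propositional.Properties using (lookup-injective)
open import Data.Product using (Σ; ∃; ∃-syntax; ∃₂; _×_; _,_; proj₁; proj₂)
open import Data.Sum using (_⊎_; inj₁; inj₂)
open import Data.Empty using (⊥; ⊥-elim)
open import Data.Unit using (tt)
open import Function using (_∘_)
open import Relation.Binary.Definitions using (tri<; tri≈; tri>)
open import Relation.Binary.PropositionalEquality using (_≡_; _≢_; refl; sym; trans; cong; cong₂; subst; module ≡-Reasoning)
open import Relation.Nullary using (Dec; yes; no; does; ¬_; contradiction)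
open import Relation.Nullary.Decidable using (_×-dec_)
open import Relation.Unary using (Pred; Decidable; U; ｛_｝; _∖_; _∩_; ∁; _⊆_; _≐_)
open import Relation.Unary.Properties using (U?; _∩?_; ∁?)
open import Algebra.Properties.CommutativeMonoid.Sum +-0-commutativeMonoid
  using (sum; sum-syntax; ∑-distrib-+; ∑-comm; sum-cong-≗; sum-remove)
open import Algebra.Solver.CommutativeMonoid Signₚ.*-commutativeMonoid using (solve; _⊕_; _⊜_; id)

private
  variable
    p : Level
    A B : Set p

-- Indicators and finite sums

χ : Dec A → ℕ
χ A? = if does A? then 1 else 0

χ-yes : (A? : Dec A) → A → χ A? ≡ 1
χ-yes (yes _) _  = refl
χ-yes (no ¬a) a  = contradiction a ¬a

χ-no : (A? : Dec A) → ¬ A → χ A? ≡ 0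
χ-no (yes a) ¬a = contradiction a ¬a
χ-no (no _)  _  = refl

χ-mono : (A? : Dec A) (B? : Dec B) → (A → B) → χ A? ≤ χ B?
χ-mono (yes a) B? A→B = ≤-reflexive (sym (χ-yes B? (A→B a)))
χ-mono (no _)  _  _   = z≤n

∑-mono : ∀ {n} {f g : Fin n → ℕ} → (∀ i → f i ≤ g i) → sum f ≤ sum g
∑-mono {zero}  _   = z≤n
∑-mono {suc n} f≤g = +-mono-≤ (f≤g fzero) (∑-mono (f≤g ∘ fsuc))

∑-const : ∀ n c → ∑[ i < n ] c ≡ n * c
∑-const zero    c = refl
∑-const (suc n) c = cong (c +_) (∑-const n c)

∑-*ʳ : ∀ {n} (f : Fin n → ℕ) c → ∑[ i < n ] (f i * c) ≡ sum f * c
∑-*ʳ {zero}  f c = refl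
∑-*ʳ {suc n} f c = trans (cong (f fzero * c +_) (∑-*ʳ (f ∘ fsuc) c)) (sym (*-distribʳ-+ c (f fzero) _))

∑-distrib-+₃ : ∀ {n} (f g h : Fin n → ℕ) → ∑[ i < n ] (f i + g i + h i) ≡ sum f + sum g + sum h
∑-distrib-+₃ f g h = trans (∑-distrib-+ (λ i → f i + g i) h) (cong (_+ sum h) (∑-distrib-+ f g))

∑-point : ∀ {n} (a : Fin n) (f : Fin n → ℕ) → ∑[ x < n ] (χ (a ≟ x) * f x) ≡ f a
∑-point {suc n} a f = begin
  ∑[ x < suc n ] (χ (a ≟ x) * f x)                             ≡⟨ sum-remove {i = a} (λ x → χ (a ≟ x) * f x) ⟩
  χ (a ≟ a) * f a + ∑[ j < n ] (χ (a ≟ punchIn a j) * f (punchIn a j))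
    ≡⟨ cong₂ _+_ (cong (_* f a) (χ-yes (a ≟ a) refl)) (sum-cong-≗ off-a) ⟩
  1 * f a + ∑[ j < n ] 0                                       ≡⟨ cong₂ _+_ (*-identityˡ (f a)) (∑-const n 0) ⟩
  f a + n * 0                                                  ≡⟨ cong (f a +_) (*-zeroʳ n) ⟩
  f a + 0                                                      ≡⟨ +-identityʳ (f a) ⟩
  f a                                                          ∎
  where
  open ≡-Reasoning
  off-a : ∀ j → χ (a ≟ punchIn a j) * f (punchIn a j) ≡ 0
  off-a j = cong (_* f (punchIn a j)) (χ-no (a ≟ punchIn a j) (punchInᵢ≢i a j ∘ sym))

module _ {n : ℕ} {p : Level} where

  private
    variable
      P Q : Pred (Fin n) p

  sumOver : Decidable P → (Fin n → ℕ) → ℕ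
  sumOver P? f = ∑[ x < n ] (χ (P? x) * f x)

  count : Decidable P → ℕ
  count P? = ∑[ x < n ] χ (P? x)

  infixl 6 _∖?_

  _∖?_ : Decidable P → (a : Fin n) → Decidable (P ∖ ｛ a ｝)
  P? ∖? a = P? ∩? ∁? (a ≟_)

  sumOver-mono : (P? : Decidable P) {f g : Fin n → ℕ} → (∀ x → P x → f x ≤ g x) → sumOver P? f ≤ sumOver P? g
  sumOver-mono P? {f} {g} f≤g = ∑-mono pointwise
    where
    pointwise : ∀ x → χ (P? x) * f x ≤ χ (P? x) * g x
    pointwise x with P? x
    ... | yes px = *-monoʳ-≤ 1 (f≤g x px)
    ... | no _   = z≤n

  sumOver-const : (P? : Decidable P) (c : ℕ) → sumOver P? (λ _ → c) ≡ count P? * c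
  sumOver-const P? c = ∑-*ʳ (χ ∘ P?) c

  sumOver-lower : (P? : Decidable P) {f : Fin n → ℕ} {t : ℕ} → (∀ x → P x → t ≤ f x) → count P? * t ≤ sumOver P? f
  sumOver-lower P? {f} {t} t≤f = subst (_≤ sumOver P? f) (sumOver-const P? t) (sumOver-mono P? t≤f)

  sumOver-remove : (P? : Decidable P) {a : Fin n} → P a → (f : Fin n → ℕ) →
                   sumOver P? f ≡ f a + sumOver (P? ∖? a) f
  sumOver-remove P? {a} pa f = begin
    ∑[ x < n ] (χ (P? x) * f x)
      ≡⟨ sum-cong-≗ split ⟩
    ∑[ x < n ] (χ (a ≟ x) * f x + χ ((P? ∖? a) x) * f x)
      ≡⟨ ∑-distrib-+ (λ x → χ (a ≟ x) * f x) (λ x → χ ((P? ∖? a) x) * f x) ⟩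
    ∑[ x < n ] (χ (a ≟ x) * f x) + sumOver (P? ∖? a) f
      ≡⟨ cong (_+ sumOver (P? ∖? a) f) (∑-point a f) ⟩
    f a + sumOver (P? ∖? a) f
      ∎
    where
    open ≡-Reasoning
    χ-split : ∀ x → χ (P? x) ≡ χ (a ≟ x) + χ ((P? ∖? a) x)
    χ-split x with a ≟ x | P? x
    ... | yes refl | yes _  = refl
    ... | yes refl | no ¬pa = contradiction pa ¬pa
    ... | no _     | yes _  = refl
    ... | no _     | no _   = refl
    split : ∀ x → χ (P? x) * f x ≡ χ (a ≟ x) * f x + χ ((P? ∖? a) x) * f x
    split x = trans (cong (_* f x) (χ-split x)) (*-distribʳ-+ (f x) (χ (a ≟ x)) (χ ((P? ∖? a) x)))

  sumOver-peel : (P? : Decidable P) {a : Fin n} {m : ℕ} (f : Fin n → ℕ) →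
                 P a → m ≤ sumOver (P? ∖? a) f → f a + m ≤ sumOver P? f
  sumOver-peel P? {a} {m} f pa m≤ = subst (f a + m ≤_) (sym (sumOver-remove P? pa f)) (+-monoʳ-≤ (f a) m≤)

  count-remove : (P? : Decidable P) {a : Fin n} → P a → count P? ≡ suc (count (P? ∖? a))
  count-remove P? {a} pa = begin
    count P?                          ≡⟨ *-identityʳ (count P?) ⟨
    count P? * 1                      ≡⟨ sumOver-const P? 1 ⟨
    sumOver P? (λ _ → 1)              ≡⟨ sumOver-remove P? pa (λ _ → 1) ⟩
    suc (sumOver (P? ∖? a) (λ _ → 1)) ≡⟨ cong suc (trans (sumOver-const (P? ∖? a) 1) (*-identityʳ _)) ⟩
    suc (count (P? ∖? a))             ∎
    where open ≡-Reasoning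

  count-nonempty : (P? : Decidable P) {a : Fin n} → P a → 0 < count P?
  count-nonempty P? pa rewrite count-remove P? pa = s≤s z≤n

  count-mono : (P? : Decidable P) (Q? : Decidable Q) → P ⊆ Q → count P? ≤ count Q?
  count-mono P? Q? P⊆Q = ∑-mono λ x → χ-mono (P? x) (Q? x) P⊆Q

  count-cong : (P? : Decidable P) (Q? : Decidable Q) → P ≐ Q → count P? ≡ count Q?
  count-cong P? Q? (P⊆Q , Q⊆P) = ≤-antisym (count-mono P? Q? P⊆Q) (count-mono Q? P? Q⊆P)

  count-insert : (P? : Decidable P) (Q? : Decidable Q) {a : Fin n} →
                 Q a → P ⊆ Q ∖ ｛ a ｝ → suc (count P?) ≤ count Q?
  count-insert P? Q? {a} qa P⊆Q∖a =
    subst (suc (count P?) ≤_) (sym (count-remove Q? qa)) (s≤s (count-mono P? (Q? ∖? a) P⊆Q∖a))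

  count-partition : (P? : Decidable P) (Q? : Decidable Q) → count (P? ∩? Q?) + count (P? ∩? ∁? Q?) ≡ count P?
  count-partition P? Q? = trans (sym (∑-distrib-+ (χ ∘ (P? ∩? Q?)) (χ ∘ (P? ∩? ∁? Q?)))) (sum-cong-≗ pointwise)
    where
    pointwise : ∀ x → χ ((P? ∩? Q?) x) + χ ((P? ∩? ∁? Q?) x) ≡ χ (P? x)
    pointwise x with P? x | Q? x
    ... | yes _ | yes _ = refl
    ... | yes _ | no _  = refl
    ... | no _  | yes _ = refl
    ... | no _  | no _  = refl

count-singleton : ∀ {n} (a : Fin n) → count (a ≟_) ≡ 1
count-singleton a = trans (sum-cong-≗ λ x → sym (*-identityʳ (χ (a ≟ x)))) (∑-point a (λ _ → 1))

count-all : ∀ n → count {n} (U? {A = Fin n}) ≡ n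
count-all n = trans (∑-const n 1) (*-identityʳ n)

sumOver-all : ∀ {n} (f : Fin n → ℕ) → sumOver U? f ≡ sum f
sumOver-all f = sum-cong-≗ (λ x → *-identityˡ (f x))


length-filter : ∀ {ℓ} {P : Pred A ℓ} (P? : Decidable P) xs →
                length (filter P? xs) ≡ List.sum (map (χ ∘ P?) xs)
length-filter P? []       = refl
length-filter P? (x ∷ xs) with P? x
... | yes _ = cong suc (length-filter P? xs)
... | no _  = length-filter P? xs

sum-map-filter : ∀ {ℓ} {P : Pred A ℓ} (f : A → ℕ) (P? : Decidable P) xs →
                 List.sum (map f (filter P? xs)) ≡ List.sum (map (λ x → χ (P? x) * f x) xs)
sum-map-filter f P? []       = refl
sum-map-filter f P? (x ∷ xs) with P? x
... | yes _ = cong₂ _+_ (sym (+-identityʳ (f x))) (sum-map-filter f P? xs)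
... | no _  = sum-map-filter f P? xs

sum-map-concatMap : (f : B → ℕ) (g : A → List B) (xs : List A) →
                    List.sum (map f (concatMap g xs)) ≡ List.sum (map (List.sum ∘ map f ∘ g) xs)
sum-map-concatMap f g []       = refl
sum-map-concatMap f g (x ∷ xs) = begin
  List.sum (map f (g x ++ concatMap g xs))           ≡⟨ cong List.sum (map-++ f (g x) _) ⟩
  List.sum (map f (g x) ++ map f (concatMap g xs))   ≡⟨ sum-++ (map f (g x)) _ ⟩
  List.sum (map f (g x)) + List.sum (map f (concatMap g xs))
    ≡⟨ cong (List.sum (map f (g x)) +_) (sum-map-concatMap f g xs) ⟩
  List.sum (map f (g x)) + List.sum (map (List.sum ∘ map f ∘ g) xs) ∎
  where open ≡-Reasoning

sum-tabulate : ∀ {n} (f : Fin n → ℕ) → List.sum (tabulate f) ≡ sum f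
sum-tabulate {zero}  f = refl
sum-tabulate {suc n} f = cong (f fzero +_) (sum-tabulate (f ∘ fsuc))

sum-map-allFin : ∀ {n} (f : Fin n → ℕ) → List.sum (map f (allFin n)) ≡ sum f
sum-map-allFin f = trans (cong List.sum (map-tabulate (λ i → i) f)) (sum-tabulate f)


s*[s*t]≡t : ∀ s t → s *ₛ (s *ₛ t) ≡ t
s*[s*t]≡t s t = trans (sym (Signₚ.*-assoc s s t)) (cong (_*ₛ t) (Signₚ.s*s≡+ s))

[r*s]*[r*t]≡s*t : ∀ r s t → (r *ₛ s) *ₛ (r *ₛ t) ≡ s *ₛ t
[r*s]*[r*t]≡s*t r s t = trans (solve 3 (λ r s t → (r ⊕ s) ⊕ (r ⊕ t) ⊜ (r ⊕ r) ⊕ (s ⊕ t)) refl r s t)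
                              (cong (_*ₛ (s *ₛ t)) (Signₚ.s*s≡+ r))

s*t≡+⇒t≡s : ∀ s t → s *ₛ t ≡ Sign.+ → t ≡ s
s*t≡+⇒t≡s s t eq = Signₚ.*-cancelˡ-≡ s t s (trans eq (sym (Signₚ.s*s≡+ s)))

triangle-positive : ∀ r s t → r *ₛ (t *ₛ (s *ₛ Sign.+)) ≡ Sign.+ → t ≡ r *ₛ s
triangle-positive r s t positive = s*t≡+⇒t≡s (r *ₛ s) t
  (trans (solve 3 (λ r s t → (r ⊕ s) ⊕ t ⊜ r ⊕ (t ⊕ (s ⊕ id))) refl r s t) positive)

quadrangle-positive : ∀ r s t u → r *ₛ (s *ₛ (t *ₛ (u *ₛ Sign.+))) ≡ Sign.+ → u ≡ r *ₛ (s *ₛ t)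
quadrangle-positive r s t u positive = s*t≡+⇒t≡s (r *ₛ (s *ₛ t)) u
  (trans (solve 4 (λ r s t u → (r ⊕ (s ⊕ t)) ⊕ u ⊜ r ⊕ (s ⊕ (t ⊕ (u ⊕ id)))) refl r s t u) positive)

commuted : ∀ {s} a b → s ≡ a *ₛ b → s ≡ b *ₛ a
commuted a b eq = trans eq (Signₚ.*-comm a b)

isNegative : Sign → Bool
isNegative Sign.- = true
isNegative Sign.+ = false

switchSign-isNegative : ∀ s → switchSign (isNegative s) ≡ s
switchSign-isNegative Sign.- = refl
switchSign-isNegative Sign.+ = refl

switched : ∀ {a b s} → s ≡ a *ₛ b → (switchSign (isNegative a) *ₛ s) *ₛ switchSign (isNegative b) ≡ Sign.+
switched {a} {b} refl rewrite switchSign-isNegative a | switchSign-isNegative b =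
  trans (cong (_*ₛ b) (s*[s*t]≡t a b)) (Signₚ.s*s≡+ b)


excess-≰ : ∀ {a b} c → a ≡ b + suc c → a ≤ b → ⊥
excess-≰ {b = b} c a≡ a≤b = m+1+n≰m b (subst (_≤ b) a≡ a≤b)

pair-lower : ∀ {a b c d N} → b + a ≡ N → suc a ≤ c → suc b ≤ d → suc (suc N) ≤ c + d
pair-lower {a} {b} {c} {d} refl a<c b<d =
  subst (_≤ c + d) (cong suc (trans (+-suc a b) (cong suc (+-comm a b)))) (+-mono-≤ a<c b<d)

far-arithmetic : ∀ {t N k d S n} → t ≡ 3 → n ≡ suc (t + N) → n ≡ suc k →
                 suc N ≤ d → d + k * t ≤ S → S + 12 ≤ 4 * n → ⊥
far-arithmetic {N = N} refl refl refl N<d below above =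
  excess-≰ 5 (identity N) (≤-trans (+-monoˡ-≤ 12 (≤-trans (+-monoˡ-≤ _ N<d) below)) above)
  where
  identity : ∀ N → suc N + (3 + N) * 3 + 12 ≡ 4 * (4 + N) + suc 5
  identity = solve-∀

two-far-arithmetic : ∀ {t N k d₁ d₂ S n} → t ≡ 2 → n ≡ suc (t + N) → n ≡ suc (suc k) →
                     suc N ≤ d₁ → suc N ≤ d₂ → d₁ + (d₂ + k * t) ≤ S → S + 12 ≤ 4 * n → ⊥
two-far-arithmetic {N = N} refl refl refl N<d₁ N<d₂ below above =
  excess-≰ 3 (identity N) (≤-trans (+-monoˡ-≤ 12 (≤-trans (+-mono-≤ N<d₁ (+-monoˡ-≤ _ N<d₂)) below)) above)
  where
  identity : ∀ N → suc N + (suc N + suc N * 2) + 12 ≡ 4 * (3 + N) + suc 3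
  identity = solve-∀

unlinked-arithmetic : ∀ {t N k S n} → 2 ≤ t → t ≤ 3 → 0 < N → n ≡ suc (t + N) → n ≡ 4 + k →
                      suc (suc N) + suc (suc N) + k * t ≤ S → S + 12 ≤ 4 * n → ⊥
unlinked-arithmetic {2} {N} _ _ _ refl refl below above =
  excess-≰ 1 (identity _) (≤-trans (+-monoˡ-≤ 12 below) above)
  where
  identity : ∀ k → suc (suc (suc k)) + suc (suc (suc k)) + k * 2 + 12 ≡ 4 * (4 + k) + suc 1
  identity = solve-∀
unlinked-arithmetic {3} {suc N} _ _ _ refl refl below above =
  excess-≰ N (identity N) (≤-trans (+-monoˡ-≤ 12 below) above)
  where
  identity : ∀ N → suc (suc (suc N)) + suc (suc (suc N)) + suc N * 3 + 12 ≡ 4 * (4 + suc N) + suc N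
  identity = solve-∀
unlinked-arithmetic {1} (s≤s ()) _ _ _ _ _ _
unlinked-arithmetic {suc (suc (suc (suc _)))} _ (s≤s (s≤s (s≤s ()))) _ _ _ _ _

n*n≡n*[n∸1]+n : ∀ n → n * n ≡ n * (n ∸ 1) + n
n*n≡n*[n∸1]+n zero    = refl
n*n≡n*[n∸1]+n (suc n) = trans (*-suc (suc n) n) (+-comm (suc n) _)


-- Adjacency, non-degrees and the handshake identity

just? : (m : Maybe Sign) → Dec (∃[ s ] m ≡ just s)
just? (just s) = yes (s , refl)
just? nothing  = no λ ()

χ-is-just : (m : Maybe Sign) → χ (is-just m Bool.≟ true) ≡ χ (just? m)
χ-is-just (just _) = refl
χ-is-just nothing  = refl


module _ {n : ℕ} (G : SignedGraph n) where

  Edge : Fin n → Fin n → Sign → Set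
  Edge x y s = adj G x y ≡ just s

  Adjacent : Fin n → Pred (Fin n) 0ℓ
  Adjacent x y = ∃[ s ] Edge x y s

  NonAdjacent : Fin n → Pred (Fin n) 0ℓ
  NonAdjacent x = ∁ ｛ x ｝ ∩ ∁ (Adjacent x)

  adjacent? : ∀ x → Decidable (Adjacent x)
  adjacent? x y = just? (adj G x y)

  nonAdjacent? : ∀ x → Decidable (NonAdjacent x)
  nonAdjacent? x = ∁? (x ≟_) ∩? ∁? (adjacent? x)

  nonDegree : Fin n → ℕ
  nonDegree x = count (nonAdjacent? x)

  nonDegreeSum : ℕ
  nonDegreeSum = ∑[ x < n ] nonDegree x

  edge-sym : ∀ {x y s} → Edge x y s → Edge y x s
  edge-sym {x} {y} e = trans (SignedGraph.sym G y x) e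

  edge-unique : ∀ {x y r s} → Edge x y r → Edge x y s → r ≡ s
  edge-unique e₁ e₂ = just-injective (trans (sym e₁) e₂)

  adjacent-sym : ∀ {x y} → Adjacent x y → Adjacent y x
  adjacent-sym (s , e) = s , edge-sym e

  adjacent⇒≢ : ∀ {x y} → Adjacent x y → x ≢ y
  adjacent⇒≢ {x} (s , e) refl with () ← trans (sym e) (loop G x)

  degree : Fin n → ℕ
  degree x = count (adjacent? x)

  χ-adjacent-sym : ∀ x y → χ (adjacent? y x) ≡ χ (adjacent? x y)
  χ-adjacent-sym x y = cong (χ ∘ just?) (SignedGraph.sym G y x)

  ordered : Fin n → Fin n → ℕ
  ordered x y = χ (toℕ x <? toℕ y)

  edgeCount-∑ : edgeCount G ≡ ∑[ x < n ] ∑[ y < n ] (ordered x y * χ (adjacent? x y))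
  edgeCount-∑ = begin
    edgeCount G
      ≡⟨ length-filter edge? (concatMap row (allFin n)) ⟩
    List.sum (map (χ ∘ edge?) (concatMap row (allFin n)))
      ≡⟨ sum-map-concatMap (χ ∘ edge?) row (allFin n) ⟩
    List.sum (map (λ x → List.sum (map (χ ∘ edge?) (row x))) (allFin n))
      ≡⟨ sum-map-allFin (λ x → List.sum (map (χ ∘ edge?) (row x))) ⟩
    ∑[ x < n ] List.sum (map (χ ∘ edge?) (row x))
      ≡⟨ sum-cong-≗ row-sum ⟩
    ∑[ x < n ] ∑[ y < n ] (ordered x y * χ (adjacent? x y))
      ∎
    where
    open ≡-Reasoning
    edge? : (e : Fin n × Fin n) → Dec (is-just (adj G (proj₁ e) (proj₂ e)) ≡ true)
    edge? e = is-just (adj G (proj₁ e) (proj₂ e)) Bool.≟ true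
    later : Fin n → List (Fin n)
    later x = filter (λ y → toℕ x <? toℕ y) (allFin n)
    row : Fin n → List (Fin n × Fin n)
    row x = map (x ,_) (later x)
    row-sum : ∀ x → List.sum (map (χ ∘ edge?) (row x)) ≡ ∑[ y < n ] (ordered x y * χ (adjacent? x y))
    row-sum x = begin
      List.sum (map (χ ∘ edge?) (map (x ,_) (later x)))    ≡⟨ cong List.sum (map-∘ (later x)) ⟨
      List.sum (map (λ y → χ (edge? (x , y))) (later x))
        ≡⟨ sum-map-filter (λ y → χ (edge? (x , y))) (λ y → toℕ x <? toℕ y) (allFin n) ⟩
      List.sum (map (λ y → ordered x y * χ (edge? (x , y))) (allFin n))
        ≡⟨ sum-map-allFin (λ y → ordered x y * χ (edge? (x , y))) ⟩
      ∑[ y < n ] (ordered x y * χ (edge? (x , y)))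
        ≡⟨ sum-cong-≗ (λ y → cong (ordered x y *_) (χ-is-just (adj G x y))) ⟩
      ∑[ y < n ] (ordered x y * χ (adjacent? x y))         ∎

  ordered-split : ∀ {x y} → x ≢ y → ordered x y + ordered y x ≡ 1
  ordered-split {x} {y} x≢y with <-cmp (toℕ x) (toℕ y)
  ... | tri< x<y _ y≮x = cong₂ _+_ (χ-yes (toℕ x <? toℕ y) x<y) (χ-no (toℕ y <? toℕ x) y≮x)
  ... | tri≈ _ x≡y _   = contradiction (toℕ-injective x≡y) x≢y
  ... | tri> x≮y _ y<x = cong₂ _+_ (χ-no (toℕ x <? toℕ y) x≮y) (χ-yes (toℕ y <? toℕ x) y<x)

  adjacent-once : ∀ x y → ordered x y * χ (adjacent? x y) + ordered y x * χ (adjacent? y x) ≡ χ (adjacent? x y)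
  adjacent-once x y rewrite χ-adjacent-sym x y with adjacent? x y
  ... | yes xy = trans (sym (*-distribʳ-+ 1 (ordered x y) (ordered y x))) (trans (*-identityʳ _) (ordered-split (adjacent⇒≢ xy)))
  ... | no _   = cong₂ _+_ (*-zeroʳ (ordered x y)) (*-zeroʳ (ordered y x))

  degree-sum : 2 * edgeCount G ≡ ∑[ x < n ] degree x
  degree-sum = begin
    2 * edgeCount G                                                 ≡⟨ cong (2 *_) edgeCount-∑ ⟩
    2 * ∑∑ forward                                                  ≡⟨ cong (∑∑ forward +_) (+-identityʳ _) ⟩
    ∑∑ forward + ∑∑ forward                                         ≡⟨ cong (∑∑ forward +_) (∑-comm forward) ⟩
    ∑∑ forward + ∑∑ backward                                        ≡⟨ ∑-distrib-+ (row forward) (row backward) ⟨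
    ∑[ x < n ] (row forward x + row backward x)                     ≡⟨ sum-cong-≗ {n} both ⟩
    ∑[ x < n ] degree x                                             ∎
    where
    open ≡-Reasoning
    forward backward : Fin n → Fin n → ℕ
    forward x y  = ordered x y * χ (adjacent? x y)
    backward x y = ordered y x * χ (adjacent? y x)
    row : (Fin n → Fin n → ℕ) → Fin n → ℕ
    row f x = ∑[ y < n ] f x y
    ∑∑ : (Fin n → Fin n → ℕ) → ℕ
    ∑∑ f = ∑[ x < n ] row f x
    both : ∀ x → row forward x + row backward x ≡ degree x
    both x = trans (sym (∑-distrib-+ (forward x) (backward x))) (sum-cong-≗ {n} (adjacent-once x))

  adjacent-nonAdjacent-equal : ∀ x y → χ (adjacent? x y) + χ (nonAdjacent? x y) + χ (x ≟ y) ≡ 1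
  adjacent-nonAdjacent-equal x y with x ≟ y
  ... | yes refl = cong (λ a → a + 0 + 1) (χ-no (adjacent? x x) λ xx → adjacent⇒≢ xx refl)
  ... | no _ with adjacent? x y
  ...   | yes _ = refl
  ...   | no _  = refl

  degree+nonDegree : ∀ x → degree x + nonDegree x + 1 ≡ n
  degree+nonDegree x = begin
    degree x + nonDegree x + 1
      ≡⟨ cong (degree x + nonDegree x +_) (count-singleton x) ⟨
    degree x + nonDegree x + count (x ≟_)
      ≡⟨ ∑-distrib-+₃ (χ ∘ adjacent? x) (χ ∘ nonAdjacent? x) (χ ∘ (x ≟_)) ⟨
    ∑[ y < n ] (χ (adjacent? x y) + χ (nonAdjacent? x y) + χ (x ≟ y))
      ≡⟨ sum-cong-≗ (adjacent-nonAdjacent-equal x) ⟩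
    count (U? {A = Fin n})
      ≡⟨ count-all n ⟩
    n ∎
    where open ≡-Reasoning

  handshake : 2 * edgeCount G + nonDegreeSum + n ≡ n * n
  handshake = begin
    2 * edgeCount G + nonDegreeSum + n
      ≡⟨ cong₂ (λ a b → a + nonDegreeSum + b) degree-sum (sym (count-all n)) ⟩
    ∑[ x < n ] degree x + nonDegreeSum + count (U? {A = Fin n})
      ≡⟨ ∑-distrib-+₃ degree nonDegree (λ _ → 1) ⟨
    ∑[ x < n ] (degree x + nonDegree x + 1)
      ≡⟨ sum-cong-≗ degree+nonDegree ⟩
    ∑[ x < n ] n
      ≡⟨ ∑-const n n ⟩
    n * n ∎
    where open ≡-Reasoning

  nonDegreeSum-bound : n * (n ∸ 1) + 12 ≤ 2 * edgeCount G + 4 * n → nonDegreeSum + 12 ≤ 4 * n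
  nonDegreeSum-bound dense = +-cancelˡ-≤ (2 * edgeCount G) _ _ (subst (_≤ 2 * edgeCount G + 4 * n) reorder dense)
    where
    n[n∸1]≡ : n * (n ∸ 1) ≡ 2 * edgeCount G + nonDegreeSum
    n[n∸1]≡ = +-cancelʳ-≡ n _ _ (trans (sym (n*n≡n*[n∸1]+n n)) (sym handshake))
    reorder : n * (n ∸ 1) + 12 ≡ 2 * edgeCount G + (nonDegreeSum + 12)
    reorder = trans (cong (_+ 12) n[n∸1]≡) (+-assoc (2 * edgeCount G) nonDegreeSum 12)

-- Short cycles

module _ {n : ℕ} (G : SignedGraph n) where

  ShortNegativeCycle : Set
  ShortNegativeCycle = ∃[ k ] (k ≤ 4 × Σ (Cycle G k) (λ C → cycleSign C ≡ Sign.-))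

  -- Positivity of a triangle or a 4-cycle, phrased as: an edge has the sign of the complementary path.
  PositiveTriangles : Set
  PositiveTriangles = ∀ {a b c r s t} → Edge G a b r → Edge G a c s → Edge G b c t → t ≡ r *ₛ s

  PositiveQuadrangles : Set
  PositiveQuadrangles = ∀ {a b c d r s t u} → a ≢ c → b ≢ d →
    Edge G a b r → Edge G b c s → Edge G c d t → Edge G a d u → u ≡ r *ₛ (s *ₛ t)

  private
    ≢-edge : ∀ {x y s} → Edge G x y s → x ≢ y
    ≢-edge e = adjacent⇒≢ G (_ , e)

  triangle : ∀ {a b c r s t} → Edge G a b r → Edge G b c t → Edge G c a s → Cycle G 3
  triangle {a} {b} {c} {r} {s} {t} ab bc ca = record
    { len≥3    = ≤-refl
    ; verts    = a ∷ b ∷ c ∷ []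
    ; distinct = λ {i} {j} → lookup-injective abc-distinct i j
    ; signs    = r ∷ t ∷ s ∷ []
    ; edges    = λ { fzero → ab ; (fsuc fzero) → bc ; (fsuc (fsuc fzero)) → ca }
    }
    where
    abc-distinct : Unique (a ∷ b ∷ c ∷ [])
    abc-distinct = (≢-edge ab ∷ (≢-edge ca ∘ sym) ∷ []) ∷ (≢-edge bc ∷ []) ∷ [] ∷ []

  quadrangle : ∀ {a b c d r s t u} → a ≢ c → b ≢ d →
               Edge G a b r → Edge G b c s → Edge G c d t → Edge G d a u → Cycle G 4
  quadrangle {a} {b} {c} {d} {r} {s} {t} {u} a≢c b≢d ab bc cd da = record
    { len≥3    = s≤s (s≤s (s≤s z≤n))
    ; verts    = a ∷ b ∷ c ∷ d ∷ []
    ; distinct = λ {i} {j} → lookup-injective abcd-distinct i j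
    ; signs    = r ∷ s ∷ t ∷ u ∷ []
    ; edges    = λ { fzero → ab ; (fsuc fzero) → bc ; (fsuc (fsuc fzero)) → cd ; (fsuc (fsuc (fsuc fzero))) → da }
    }
    where
    abcd-distinct : Unique (a ∷ b ∷ c ∷ d ∷ [])
    abcd-distinct = (≢-edge ab ∷ a≢c ∷ (≢-edge da ∘ sym) ∷ [])
                  ∷ (≢-edge bc ∷ b≢d ∷ []) ∷ (≢-edge cd ∷ []) ∷ [] ∷ []

  triangle? : ∀ a b c → ShortNegativeCycle ⊎
              (∀ {r s t} → Edge G a b r → Edge G a c s → Edge G b c t → t ≡ r *ₛ s)
  triangle? a b c with adj G a b in ab | adj G a c in ac | adj G b c in bc
  ... | nothing | _       | _       = inj₂ λ ()
  ... | just _  | nothing | _       = inj₂ λ _ ()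
  ... | just _  | just _  | nothing = inj₂ λ _ _ ()
  ... | just r  | just s  | just t with r *ₛ (t *ₛ (s *ₛ Sign.+)) in sign
  ...   | Sign.- = inj₁ (3 , s≤s (s≤s (s≤s z≤n)) , triangle ab bc (edge-sym G ac) , sign)
  ...   | Sign.+ = inj₂ λ ab′ ac′ bc′ →
    trans (sym (just-injective bc′))
      (trans (triangle-positive r s t sign) (cong₂ _*ₛ_ (just-injective ab′) (just-injective ac′)))

  quadrangle? : ∀ a b c d → ShortNegativeCycle ⊎
                (∀ {r s t u} → a ≢ c → b ≢ d →
                 Edge G a b r → Edge G b c s → Edge G c d t → Edge G a d u → u ≡ r *ₛ (s *ₛ t))
  quadrangle? a b c d with a ≟ c | b ≟ d
  ... | yes a≡c | _       = inj₂ λ a≢c _ _ _ _ _ → contradiction a≡c a≢c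
  ... | no _    | yes b≡d = inj₂ λ _ b≢d _ _ _ _ → contradiction b≡d b≢d
  ... | no a≢c  | no b≢d with adj G a b in ab | adj G b c in bc | adj G c d in cd | adj G a d in ad
  ...   | nothing | _       | _       | _       = inj₂ λ _ _ ()
  ...   | just _  | nothing | _       | _       = inj₂ λ _ _ _ ()
  ...   | just _  | just _  | nothing | _       = inj₂ λ _ _ _ _ ()
  ...   | just _  | just _  | just _  | nothing = inj₂ λ _ _ _ _ _ ()
  ...   | just r  | just s  | just t  | just u with r *ₛ (s *ₛ (t *ₛ (u *ₛ Sign.+))) in sign
  ...     | Sign.- = inj₁ (4 , ≤-refl , quadrangle a≢c b≢d ab bc cd (edge-sym G ad) , sign)
  ...     | Sign.+ = inj₂ λ _ _ ab′ bc′ cd′ ad′ →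
    trans (sym (just-injective ad′))
      (trans (quadrangle-positive r s t u sign)
        (cong₂ _*ₛ_ (just-injective ab′) (cong₂ _*ₛ_ (just-injective bc′) (just-injective cd′))))

first-or-all : ∀ {k a b} {A : Set a} {B : Fin k → Set b} → (∀ x → A ⊎ B x) → A ⊎ (∀ x → B x)
first-or-all {zero}  _ = inj₂ λ ()
first-or-all {suc k} f with f fzero | first-or-all (f ∘ fsuc)
... | inj₁ a | _      = inj₁ a
... | inj₂ _ | inj₁ a = inj₁ a
... | inj₂ b | inj₂ bs = inj₂ λ { fzero → b ; (fsuc x) → bs x }

module _ {n : ℕ} (G : SignedGraph n) where

  negative-or-positive : ShortNegativeCycle G ⊎ (PositiveTriangles G × PositiveQuadrangles G)
  negative-or-positive
    with first-or-all (λ a → first-or-all λ b → first-or-all λ c → triangle? G a b c)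
       | first-or-all (λ a → first-or-all λ b → first-or-all λ c → first-or-all λ d → quadrangle? G a b c d)
  ... | inj₁ cycle | _          = inj₁ cycle
  ... | inj₂ _     | inj₁ cycle = inj₁ cycle
  ... | inj₂ tri   | inj₂ quad  = inj₂ ((λ {a} {b} {c} → tri a b c) , λ {a} {b} {c} {d} → quad a b c d)

-- The switching built from a vertex of minimum non-degree

module Switching {n : ℕ} (G : SignedGraph n)
  (positive-triangles : PositiveTriangles G) (positive-quadrangles : PositiveQuadrangles G)
  (sparse-complement : nonDegreeSum G + 12 ≤ 4 * n)
  (v : Fin n) (v-minimal : ∀ x → nonDegree G v ≤ nonDegree G x) where

  t : ℕ
  t = nonDegree G v

  Neighbour : Pred (Fin n) 0ℓ
  Neighbour = Adjacent G v

  Distant : Pred (Fin n) 0ℓ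
  Distant = NonAdjacent G v

  NearVia : Fin n → Pred (Fin n) 0ℓ
  NearVia x = Neighbour ∩ (λ m → Adjacent G m x)

  Near : Pred (Fin n) 0ℓ
  Near x = ∃ (NearVia x)

  Far : Pred (Fin n) 0ℓ
  Far = Distant ∩ ∁ Near

  vertex? : Decidable (U {A = Fin n})
  vertex? = U?

  neighbour? : Decidable Neighbour
  neighbour? = adjacent? G v

  distant? : Decidable Distant
  distant? = nonAdjacent? G v

  nearVia? : ∀ x → Decidable (NearVia x)
  nearVia? x = neighbour? ∩? (λ m → adjacent? G m x)

  near? : Decidable Near
  near? x = any? (nearVia? x)

  distant≢neighbour : ∀ {x m} → Distant x → Neighbour m → x ≢ m
  distant≢neighbour (_ , ¬vx) vm refl = ¬vx vm

  far-neighbour-distant : ∀ {x y} → Far y → Adjacent G x y → Distant x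
  far-neighbour-distant ((_ , ¬vy) , ¬near) xy = (λ { refl → ¬vy xy }) , λ vx → ¬near (_ , vx , xy)

  nonDegreeSum-peel : ∀ {P : Pred (Fin n) 0ℓ} (P? : Decidable P) {a m} →
                      P a → m ≤ sumOver (P? ∖? a) (nonDegree G) → nonDegree G a + m ≤ sumOver P? (nonDegree G)
  nonDegreeSum-peel P? = sumOver-peel P? (nonDegree G)

  nonDegreeSum-rest : ∀ {P : Pred (Fin n) 0ℓ} (P? : Decidable P) → count P? * t ≤ sumOver P? (nonDegree G)
  nonDegreeSum-rest P? = sumOver-lower P? (λ x _ → v-minimal x)

  ≤nonDegreeSum⇒ : ∀ {m} → m ≤ sumOver vertex? (nonDegree G) → m + 12 ≤ 4 * n
  ≤nonDegreeSum⇒ m≤ = ≤-trans (+-monoˡ-≤ 12 (subst (_ ≤_) (sumOver-all (nonDegree G)) m≤)) sparse-complement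

  t≤3 : t ≤ 3
  t≤3 with t ≤? 3
  ... | yes t≤3 = t≤3
  ... | no t≰3 = ⊥-elim (m+1+n≰m (4 * n) (begin
    4 * n + 12     ≤⟨ +-monoˡ-≤ 12 (subst (_≤ n * t) (*-comm n 4) (*-monoʳ-≤ n (≰⇒> t≰3))) ⟩
    n * t + 12     ≡⟨ cong (λ k → k * t + 12) (count-all n) ⟨
    count vertex? * t + 12 ≤⟨ ≤nonDegreeSum⇒ (nonDegreeSum-rest vertex?) ⟩
    4 * n          ∎))
    where open ≤-Reasoning

  vertex-partition : n ≡ suc (t + count neighbour?)
  vertex-partition = begin
    n                                                  ≡⟨ count-all n ⟨
    count vertex?                                           ≡⟨ count-remove vertex? {v} tt ⟩
    suc (count (vertex? ∖? v))                              ≡⟨ cong suc (count-partition (vertex? ∖? v) neighbour?) ⟨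
    suc (count ((vertex? ∖? v) ∩? neighbour?) + count ((vertex? ∖? v) ∩? ∁? neighbour?))
      ≡⟨ cong suc (trans (+-comm (count ((vertex? ∖? v) ∩? neighbour?)) _)
                         (cong₂ _+_ (count-cong ((vertex? ∖? v) ∩? ∁? neighbour?) distant? distant⇔)
                                    (count-cong ((vertex? ∖? v) ∩? neighbour?) neighbour? neighbour⇔))) ⟩
    suc (t + count neighbour?)                         ∎
    where
    open ≡-Reasoning
    distant⇔ : (U ∖ ｛ v ｝) ∩ ∁ Neighbour ≐ Distant
    distant⇔ = (λ ((_ , v≢x) , ¬vx) → v≢x , ¬vx) , λ (v≢x , ¬vx) → (tt , v≢x) , ¬vx
    neighbour⇔ : (U ∖ ｛ v ｝) ∩ Neighbour ≐ Neighbour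
    neighbour⇔ = proj₂ , λ vx → (tt , adjacent⇒≢ G vx) , vx

  two-distant : ∀ {a b} → Distant a → Distant b → a ≢ b → 2 ≤ t
  two-distant {a} da db a≢b = begin
    2                            ≤⟨ s≤s (count-nonempty (distant? ∖? a) (db , a≢b)) ⟩
    suc (count (distant? ∖? a))  ≡⟨ count-remove distant? da ⟨
    t                            ∎
    where open ≤-Reasoning

  three-distant : ∀ {a b c} → Distant a → Distant b → Distant c → a ≢ b → a ≢ c → b ≢ c → 3 ≤ t
  three-distant {a} {b} da db dc a≢b a≢c b≢c = begin
    3                                             ≤⟨ s≤s (s≤s (count-nonempty (distant? ∖? a ∖? b) ((dc , a≢c) , b≢c))) ⟩
    suc (suc (count (distant? ∖? a ∖? b)))        ≡⟨ cong suc (count-remove (distant? ∖? a) (db , a≢b)) ⟨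
    suc (count (distant? ∖? a))                   ≡⟨ count-remove distant? da ⟨
    t                                             ∎
    where open ≤-Reasoning

  nonDegree-distant : ∀ {x} → Distant x → suc (count (neighbour? ∩? ∁? (λ m → adjacent? G m x))) ≤ nonDegree G x
  nonDegree-distant {x} (v≢x , ¬vx) =
    count-insert (neighbour? ∩? ∁? (λ m → adjacent? G m x)) (nonAdjacent? G x)
      ((v≢x ∘ sym) , ¬vx ∘ adjacent-sym G)
      λ (vm , ¬mx) → ((λ { refl → ¬vx vm }) , ¬mx ∘ adjacent-sym G) , adjacent⇒≢ G vm

  nonDegree-far : ∀ {x} → Far x → suc (count neighbour?) ≤ nonDegree G x
  nonDegree-far (dx , ¬near) = ≤-trans
    (s≤s (count-mono neighbour? (neighbour? ∩? ∁? (λ m → adjacent? G m _)) λ vm → vm , λ mx → ¬near (_ , vm , mx)))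
    (nonDegree-distant dx)

  far⇒t≤2 : ∀ {x} → Far x → t ≤ 2
  far⇒t≤2 {x} fx with t ≤? 2
  ... | yes t≤2 = t≤2
  ... | no t≰2 = ⊥-elim (far-arithmetic (≤-antisym t≤3 (≰⇒> t≰2)) vertex-partition
    (trans (sym (count-all n)) (count-remove vertex? {x} tt))
    (nonDegree-far fx)
    (nonDegreeSum-peel vertex? tt (nonDegreeSum-rest (vertex? ∖? x)))
    (≤nonDegreeSum⇒ ≤-refl))

  far-unique : ∀ {x y} → Far x → Far y → x ≡ y
  far-unique {x} {y} fx fy with x ≟ y
  ... | yes x≡y = x≡y
  ... | no x≢y = ⊥-elim (two-far-arithmetic t≡2 vertex-partition
    (trans (sym (count-all n)) (trans (count-remove vertex? {x} tt) (cong suc (count-remove (vertex? ∖? x) (tt , x≢y)))))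
    (nonDegree-far fx) (nonDegree-far fy)
    (nonDegreeSum-peel vertex? tt (nonDegreeSum-peel (vertex? ∖? x) (tt , x≢y) (nonDegreeSum-rest (vertex? ∖? x ∖? y))))
    (≤nonDegreeSum⇒ ≤-refl))
    where
    t≡2 : t ≡ 2
    t≡2 = ≤-antisym (far⇒t≤2 fx) (two-distant (proj₁ fx) (proj₁ fy) x≢y)

  far-neighbour-unique : ∀ {x y z} → Far z → Adjacent G x z → Adjacent G y z → x ≡ y
  far-neighbour-unique {x} {y} fz xz yz with x ≟ y
  ... | yes x≡y = x≡y
  ... | no x≢y = ⊥-elim (<⇒≱ (s≤s (far⇒t≤2 fz))
    (three-distant (proj₁ fz) (far-neighbour-distant fz xz) (far-neighbour-distant fz yz)
                   (adjacent⇒≢ G xz ∘ sym) (adjacent⇒≢ G yz ∘ sym) x≢y))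

  CommonNeighbour : Fin n → Fin n → Set
  CommonNeighbour x y = ∃ (NearVia x ∩ NearVia y)

  LinkedNeighbours : Fin n → Fin n → Set
  LinkedNeighbours x y = ∃₂ λ a b → NearVia x a × NearVia y b × Adjacent G a b

  nonDegree-unlinked : ∀ {x y a} → Distant y → ¬ CommonNeighbour x y → ¬ LinkedNeighbours x y →
                       NearVia x a → suc (count (nearVia? y)) ≤ nonDegree G a
  nonDegree-unlinked {x} {y} {a} dy no-common no-link xa@(va , _) =
    count-insert (nearVia? y) (nonAdjacent? G a)
      (distant≢neighbour dy va ∘ sym , λ ay → no-common (a , xa , va , ay))
      λ {b} yb → ((λ { refl → no-common (a , xa , yb) }) , λ ab → no-link (a , b , xa , yb , ab))
               , distant≢neighbour dy (proj₁ yb)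

  -- nonDegree x + nonDegree b ≥ |N(v)| + 2, since x misses v and the neighbours of v outside N(x), while b
  -- misses x and those inside; likewise for y and a. With t ≥ 2 this is too much for 4n − 12.
  unlinked-near-pair : ∀ {x y a b} → Distant x → Distant y → x ≢ y → NearVia x a → NearVia y b →
                       ¬ CommonNeighbour x y → ¬ LinkedNeighbours x y → ⊥
  unlinked-near-pair {x} {y} {a} {b} dx dy x≢y xa yb no-common no-link =
    unlinked-arithmetic (two-distant dx dy x≢y) t≤3 (count-nonempty neighbour? (proj₁ xa))
      vertex-partition four-removed (≤-trans (+-monoˡ-≤ (count rest? * t) pair-bounds) peeled) (≤nonDegreeSum⇒ ≤-refl)
    where
    N = count neighbour?
    nd = nonDegree G
    x≢a = distant≢neighbour dx (proj₁ xa)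
    x≢b = distant≢neighbour dx (proj₁ yb)
    y≢a = distant≢neighbour dy (proj₁ xa)
    y≢b = distant≢neighbour dy (proj₁ yb)
    a≢b : a ≢ b
    a≢b refl = no-common (a , xa , yb)
    y∈ = tt , x≢y
    a∈ = (tt , x≢a) , y≢a
    b∈ = ((tt , x≢b) , y≢b) , a≢b
    rest? = vertex? ∖? x ∖? y ∖? a ∖? b

    four-removed : n ≡ 4 + count rest?
    four-removed = begin
      n                                    ≡⟨ count-all n ⟨
      count vertex?                        ≡⟨ count-remove vertex? {x} tt ⟩
      1 + count (vertex? ∖? x)             ≡⟨ cong suc (count-remove (vertex? ∖? x) y∈) ⟩
      2 + count (vertex? ∖? x ∖? y)        ≡⟨ cong (2 +_) (count-remove (vertex? ∖? x ∖? y) a∈) ⟩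
      3 + count (vertex? ∖? x ∖? y ∖? a)   ≡⟨ cong (3 +_) (count-remove (vertex? ∖? x ∖? y ∖? a) b∈) ⟩
      4 + count rest?                      ∎
      where open ≡-Reasoning

    no-common′ : ¬ CommonNeighbour y x
    no-common′ (c , yc , xc) = no-common (c , xc , yc)
    no-link′ : ¬ LinkedNeighbours y x
    no-link′ (c , d , yc , xd , cd) = no-link (d , c , xd , yc , adjacent-sym G cd)

    pair-bounds : suc (suc N) + suc (suc N) ≤ (nd x + nd b) + (nd y + nd a)
    pair-bounds = +-mono-≤
      (pair-lower (count-partition neighbour? (λ m → adjacent? G m x))
                  (nonDegree-distant dx) (nonDegree-unlinked dx no-common′ no-link′ yb))
      (pair-lower (count-partition neighbour? (λ m → adjacent? G m y))
                  (nonDegree-distant dy) (nonDegree-unlinked dy no-common no-link xa))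

    peeled : (nd x + nd b) + (nd y + nd a) + count rest? * t ≤ sumOver vertex? nd
    peeled = begin
      (nd x + nd b) + (nd y + nd a) + count rest? * t      ≡⟨ regroup (nd x) (nd y) (nd a) (nd b) (count rest? * t) ⟩
      nd x + (nd y + (nd a + (nd b + count rest? * t)))    ≤⟨ nonDegreeSum-peel vertex? tt
                                                               (nonDegreeSum-peel (vertex? ∖? x) y∈
                                                               (nonDegreeSum-peel (vertex? ∖? x ∖? y) a∈
                                                               (nonDegreeSum-peel (vertex? ∖? x ∖? y ∖? a) b∈
                                                               (nonDegreeSum-rest rest?)))) ⟩
      sumOver vertex? nd                                   ∎
      where
      open ≤-Reasoning
      regroup : ∀ p q r s u → (p + s) + (q + r) + u ≡ p + (q + (r + (s + u)))
      regroup = solve-∀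

  near-pair-linked : ∀ {x y} → Distant x → Distant y → x ≢ y → Near x → Near y →
                     CommonNeighbour x y ⊎ LinkedNeighbours x y
  near-pair-linked {x} {y} dx dy x≢y (a , xa) (b , yb) with any? (nearVia? x ∩? nearVia? y)
  ... | yes common = inj₁ common
  ... | no ¬common with any? (λ c → any? λ d → nearVia? x c ×-dec nearVia? y d ×-dec adjacent? G c d)
  ...   | yes (c , d , link) = inj₂ (c , d , link)
  ...   | no ¬linked = ⊥-elim (unlinked-near-pair dx dy x≢y xa yb ¬common ¬linked)

  nearSign : ∀ {x} → Near x → Sign
  nearSign (_ , (r , _) , (s , _)) = r *ₛ s

  nearSign-unique : ∀ {x} → Distant x → (p q : Near x) → nearSign p ≡ nearSign q
  nearSign-unique (v≢x , _) (m , (r , vm) , (a , mx)) (m′ , (r′ , vm′) , (a′ , m′x)) with m ≟ m′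
  ... | yes refl = cong₂ _*ₛ_ (edge-unique G vm vm′) (edge-unique G mx m′x)
  ... | no m≢m′  = sym (begin
    r′ *ₛ a′                ≡⟨ cong (_*ₛ a′) (positive-quadrangles v≢x m≢m′ vm mx (edge-sym G m′x) vm′) ⟩
    (r *ₛ (a *ₛ a′)) *ₛ a′  ≡⟨ solve 3 (λ r a a′ → (r ⊕ (a ⊕ a′)) ⊕ a′ ⊜ (r ⊕ a) ⊕ (a′ ⊕ a′)) refl r a a′ ⟩
    (r *ₛ a) *ₛ (a′ *ₛ a′)  ≡⟨ cong ((r *ₛ a) *ₛ_) (Signₚ.s*s≡+ a′) ⟩
    (r *ₛ a) *ₛ Sign.+      ≡⟨ Signₚ.*-identityʳ (r *ₛ a) ⟩
    r *ₛ a                  ∎)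
    where open ≡-Reasoning

  nearNeighbour? : ∀ x → Dec (∃ λ y → Near y × Adjacent G y x)
  nearNeighbour? x = any? (λ y → near? y ×-dec adjacent? G y x)

  -- A far vertex has at most one neighbour, and it is near (far vertices are unique and not adjacent to
  -- neighbours of v), so that single edge determines the sign.
  farSign : ∀ {x} → Dec (∃ λ y → Near y × Adjacent G y x) → Sign
  farSign (yes (_ , p , (s , _))) = nearSign p *ₛ s
  farSign (no _)                 = Sign.+

  farSign-spec : ∀ {x y s} → Distant x → (p : Near x) → Far y → Edge G x y s →
                 farSign (nearNeighbour? y) ≡ nearSign p *ₛ s
  farSign-spec {x} {y} {s} dx p fy xy with nearNeighbour? y
  ... | no none = contradiction (x , p , (s , xy)) none
  ... | yes (x′ , p′ , (s′ , x′y)) with far-neighbour-unique fy (s′ , x′y) (s , xy)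
  ...   | refl = cong₂ _*ₛ_ (nearSign-unique dx p′ p) (edge-unique G x′y xy)

  data Position (x : Fin n) : Set where
    centre    : v ≡ x → Position x
    neighbour : ∀ {s} → Edge G v x s → Position x
    near      : Distant x → Near x → Position x
    far       : Far x → Position x

  position : ∀ x → Position x
  position x with v ≟ x | neighbour? x | near? x
  ... | yes v≡x | _            | _     = centre v≡x
  ... | no _    | yes (_ , vx) | _     = neighbour vx
  ... | no v≢x  | no ¬vx       | yes p = near (v≢x , ¬vx) p
  ... | no v≢x  | no ¬vx       | no ¬p = far ((v≢x , ¬vx) , ¬p)

  signAt : ∀ {x} → Position x → Sign
  signAt (centre _)          = Sign.+
  signAt (neighbour {s} _)   = s
  signAt (near _ p)          = nearSign p
  signAt {x} (far _)         = farSign (nearNeighbour? x)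

  potential : Fin n → Sign
  potential x = signAt (position x)

  neighbour-near : ∀ {x y r s} → Edge G v x r → Distant y → (q : Near y) → Edge G x y s → s ≡ r *ₛ nearSign q
  neighbour-near {x} {r = r} {s} vx dy q xy =
    trans (sym (s*[s*t]≡t r s)) (cong (r *ₛ_) (nearSign-unique dy (x , (r , vx) , (s , xy)) q))

  near-near : ∀ {x y s} → Distant x → (p : Near x) → Distant y → (q : Near y) → Edge G x y s →
              s ≡ nearSign p *ₛ nearSign q
  near-near {s = s} dx p dy q xy with near-pair-linked dx dy (adjacent⇒≢ G (_ , xy)) p q
  ... | inj₁ (c , ((r , vc) , (a , cx)) , (_ , (b , cy))) = begin
    s                         ≡⟨ positive-triangles cx cy xy ⟩
    a *ₛ b                    ≡⟨ [r*s]*[r*t]≡s*t r a b ⟨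
    (r *ₛ a) *ₛ (r *ₛ b)      ≡⟨ cong₂ _*ₛ_ (nearSign-unique dx (c , (r , vc) , (a , cx)) p)
                                            (nearSign-unique dy (c , (r , vc) , (b , cy)) q) ⟩
    nearSign p *ₛ nearSign q  ∎
    where open ≡-Reasoning
  ... | inj₂ (m₁ , m₂ , ((r₁ , vm₁) , (a , m₁x)) , ((r₂ , vm₂) , (b , m₂y)) , (c , m₁m₂)) = begin
    s                         ≡⟨ positive-quadrangles (distant≢neighbour dx (r₂ , vm₂))
                                                      (distant≢neighbour dy (r₁ , vm₁) ∘ sym)
                                                      (edge-sym G m₁x) m₁m₂ m₂y xy ⟩
    a *ₛ (c *ₛ b)             ≡⟨ cong (λ c → a *ₛ (c *ₛ b)) (positive-triangles vm₁ vm₂ m₁m₂) ⟩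
    a *ₛ ((r₁ *ₛ r₂) *ₛ b)    ≡⟨ solve 4 (λ a r₁ r₂ b → a ⊕ ((r₁ ⊕ r₂) ⊕ b) ⊜ (r₁ ⊕ a) ⊕ (r₂ ⊕ b))
                                       refl a r₁ r₂ b ⟩
    (r₁ *ₛ a) *ₛ (r₂ *ₛ b)    ≡⟨ cong₂ _*ₛ_ (nearSign-unique dx (m₁ , (r₁ , vm₁) , (a , m₁x)) p)
                                            (nearSign-unique dy (m₂ , (r₂ , vm₂) , (b , m₂y)) q) ⟩
    nearSign p *ₛ nearSign q  ∎
    where open ≡-Reasoning

  near-far : ∀ {x y s} → Distant x → (p : Near x) → Far y → Edge G x y s →
             s ≡ nearSign p *ₛ farSign (nearNeighbour? y)
  near-far {s = s} dx p fy xy =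
    trans (sym (s*[s*t]≡t (nearSign p) s)) (cong (nearSign p *ₛ_) (sym (farSign-spec dx p fy xy)))

  balancedAt : ∀ {x y s} (px : Position x) (py : Position y) → Edge G x y s → s ≡ signAt px *ₛ signAt py
  balancedAt (centre refl)          (centre refl)          xy = ⊥-elim (adjacent⇒≢ G (_ , xy) refl)
  balancedAt (centre refl)          (neighbour vy)         xy = edge-unique G xy vy
  balancedAt (centre refl)          (near (_ , ¬vy) _)     xy = ⊥-elim (¬vy (_ , xy))
  balancedAt (centre refl)          (far ((_ , ¬vy) , _))  xy = ⊥-elim (¬vy (_ , xy))
  balancedAt px@(neighbour vx)      py@(centre refl)       xy =
    commuted (signAt py) (signAt px) (edge-unique G (edge-sym G xy) vx)
  balancedAt (neighbour vx)         (neighbour vy)         xy = positive-triangles vx vy xy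
  balancedAt (neighbour vx)         (near dy q)            xy = neighbour-near vx dy q xy
  balancedAt (neighbour vx)         (far (_ , ¬near))      xy = ⊥-elim (¬near (_ , (_ , vx) , (_ , xy)))
  balancedAt (near (_ , ¬vx) _)     (centre refl)          xy = ⊥-elim (¬vx (_ , edge-sym G xy))
  balancedAt px@(near dx p)         py@(neighbour vy)      xy =
    commuted (signAt py) (signAt px) (neighbour-near vy dx p (edge-sym G xy))
  balancedAt (near dx p)            (near dy q)            xy = near-near dx p dy q xy
  balancedAt (near dx p)            (far fy)               xy = near-far dx p fy xy
  balancedAt (far ((_ , ¬vx) , _))  (centre refl)          xy = ⊥-elim (¬vx (_ , edge-sym G xy))
  balancedAt (far (_ , ¬near))      (neighbour vy)         xy = ⊥-elim (¬near (_ , (_ , vy) , (_ , edge-sym G xy)))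
  balancedAt px@(far fx)            py@(near dy q)         xy =
    commuted (signAt py) (signAt px) (near-far dy q fx (edge-sym G xy))
  balancedAt (far fx)               (far fy)               xy = ⊥-elim (adjacent⇒≢ G (_ , xy) (far-unique fx fy))

  balanced : Balanced G
  balanced = isNegative ∘ potential , λ i j s ij →
    switched {potential i} {potential j} (balancedAt (position i) (position j) ij)

positive-short-cycles⇒balanced : ∀ {n} (G : SignedGraph n) → PositiveTriangles G → PositiveQuadrangles G →
                                 nonDegreeSum G + 12 ≤ 4 * n → Balanced G
positive-short-cycles⇒balanced {zero}  G _   _    _      = (λ ()) , λ ()
positive-short-cycles⇒balanced {suc m} G tri quad sparse = Switching.balanced G tri quad sparse v v-minimal
  where
  v : Fin (suc m)
  v = argmin (nonDegree G) fzero (allFin (suc m))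
  v-minimal : ∀ x → nonDegree G v ≤ nonDegree G x
  v-minimal x = All.lookup (f[argmin]≤f[xs] {f = nonDegree G} fzero (allFin (suc m))) (∈-allFin x)

lemma2p5 : (n : ℕ) (G : SignedGraph n) → Unbalanced G →
    n * (n ∸ 1) + 12 ≤ 2 * edgeCount G + 4 * n →
    ∃[ k ] (k ≤ 4 × Σ (Cycle G k) (λ C → cycleSign C ≡ Sign.-))
lemma2p5 n G unbalanced dense with negative-or-positive G
... | inj₁ short-negative-cycle = short-negative-cycle
... | inj₂ (tri , quad) = contradiction (positive-short-cycles⇒balanced G tri quad (nonDegreeSum-bound G dense)) unbalanced
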